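{- Let $T$ be a decomposition tree and $v$ an internal node of $T$ labeled $\otimes$, with left child $v_l$ and right child $v_r$. Then $\widehat{\min}(v)=\widehat{\min}(v_l)+\widehat{\min}(v_r)$.
   Context: All graphs are finite, simple and undirected. For a graph $H$ and $S\subseteq V(H)$, $N_H[S]$ is the closed neighbourhood of $S$ in $H$ and $H[S]$ the induced subgraph; a graph with no vertices is regarded as having a (empty) perfect matching. A decomposition tree is a rooted tree $T$ in which every internal node has exactly two children, a left child $v_l$ and a right child $v_r$, and carries one of the labels $\otimes$ (true twin), $\odot$ (false twin), $\oplus$ (attachment). To each node $v$ are associated a graph $\hat G(v)$ and a twin set $\hat{TS}(v)\subseteq V(\hat G(v))$: for a leaf, $\hat G(v)$ is a single vertex $x$ (distinct leaves giving distinct vertices) and $\hat{TS}(v)=\{x\}$; for an internal node $v$, $V(\hat G(v))=V(\hat G(v_l))\cup V(\hat G(v_r))$ and: if $v$ is labeled $\otimes$, $E(\hat G(v))=E(\hat G(v_l))\cup E(\hat G(v_r))\cup\{xy: x\in \hat{TS}(v_l), y\in\hat{TS}(v_r)\}$ and $\hat{TS}(v)=\hat{TS}(v_l)\cup\hat{TS}(v_r)$; if labeled $\odot$, $E(\hat G(v))=E(\hat G(v_l))\cup E(\hat G(v_r))$ and $\hat{TS}(v)=\hat{TS}(v_l)\cup\hat{TS}(v_r)$; if labeled $\oplus$, the edge set is as for $\otimes$ and $\hat{TS}(v)=\hat{TS}(v_l)$. For a node $u$ and $0\le k\le|\hat{TS}(u)|$, $\hat\gamma_k(u)$ is the minimum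 of $|S|$ over all $S\subseteq V(\hat G(u))$ with $V(\hat G(u))\setminus \hat{TS}(u)\subseteq N_{\hat G(u)}[S]$ for which there is $X\subseteq S\cap\hat{TS}(u)$, $|X|=k$, such that $\hat G(u)[S\setminus X]$ has a perfect matching. Let $\widehat{\min}(u)=\min\{\hat\gamma_k(u):0\le k\le|\hat{TS}(u)|\}$. -}

module Defs where

open import Data.Nat using (ℕ; _+_; _≤_)
open import Data.Bool using (Bool; true; false; _∧_)
open import Data.Fin using (Fin; splitAt)
open import Data.Fin.Subset using (Subset; _∈_; _∉_; _⊆_; _∩_; _─_; ∣_∣; inside; outside)
open import Data.Vec using (_++_; replicate; lookup)
open import Data.Sum using (_⊎_; inj₁; inj₂)
open import Data.Product using (Σ; _×_; ∃; _,_)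
open import Relation.Binary.PropositionalEquality using (_≡_)

-- Labels of internal nodes: ⊗ (true twin), ⊙ (false twin), ⊕ (attachment)
data Label : Set where
  ⊗ ⊙ ⊕ : Label

data DTree : Set where
  leaf : DTree
  node : Label → DTree → DTree → DTree

-- Number of vertices of Ĝ(v) = number of leaves below v.
-- The vertices of Ĝ(node _ l r) are Fin (size l + size r): the first
-- size l of them are the vertices of Ĝ(l), the rest those of Ĝ(r).
size : DTree → ℕ
size leaf = 1
size (node _ l r) = size l + size r

TS : (t : DTree) → Subset (size t)
TS leaf = inside Data.Vec.∷ Data.Vec.[]
TS (node ⊗ l r) = TS l ++ TS r
TS (node ⊙ l r) = TS l ++ TS r
TS (node ⊕ l r) = TS l ++ replicate (size r) outside

cross : Label → Bool → Bool → Bool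
cross ⊗ a b = a ∧ b
cross ⊙ a b = false
cross ⊕ a b = a ∧ b

adj : (t : DTree) → Fin (size t) → Fin (size t) → Bool
adj leaf x y = false
adj (node lab l r) x y with splitAt (size l) x | splitAt (size l) y
... | inj₁ a | inj₁ b = adj l a b
... | inj₂ a | inj₂ b = adj r a b
... | inj₁ a | inj₂ b = cross lab (lookup (TS l) a) (lookup (TS r) b)
... | inj₂ a | inj₁ b = cross lab (lookup (TS l) b) (lookup (TS r) a)

Adj : (t : DTree) → Fin (size t) → Fin (size t) → Set
Adj t x y = adj t x y ≡ true

InClosedNbhd : (t : DTree) → Subset (size t) → Fin (size t) → Set
InClosedNbhd t S x = ∃ λ y → y ∈ S × (y ≡ x ⊎ Adj t y x)

IsPerfectMatching : (t : DTree) → Subset (size t) →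
                    (Fin (size t) → Fin (size t) → Bool) → Set
IsPerfectMatching t W M =
  (∀ x y → M x y ≡ true → Adj t x y × x ∈ W × y ∈ W × M y x ≡ true) ×
  (∀ x → x ∈ W → ∃ λ y → M x y ≡ true × (∀ z → M x z ≡ true → z ≡ y))

HasPerfectMatching : (t : DTree) → Subset (size t) → Set
HasPerfectMatching t W = ∃ λ M → IsPerfectMatching t W M

Admissible : (t : DTree) → ℕ → Subset (size t) → Set
Admissible t k S =
  (∀ x → x ∉ TS t → InClosedNbhd t S x) ×
  (∃ λ X → X ⊆ S ∩ TS t × ∣ X ∣ ≡ k × HasPerfectMatching t (S ─ X))

IsGammaHat : (t : DTree) → ℕ → ℕ → Set
IsGammaHat t k m =
  (∃ λ S → Admissible t k S × ∣ S ∣ ≡ m) ×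
  (∀ S → Admissible t k S → m ≤ ∣ S ∣)

-- m = min^(t) = min { γ^_k(t) : 0 ≤ k ≤ |TS(t)| }  (over the k for which γ^_k(t) is defined)
IsMinHat : (t : DTree) → ℕ → Set
IsMinHat t m =
  (∃ λ k → k ≤ ∣ TS t ∣ × IsGammaHat t k m) ×
  (∀ k → k ≤ ∣ TS t ∣ → ∀ g → IsGammaHat t k g → m ≤ g)

-- Call S admissible for k if it satisfies the conditions in the definition of γ̂_k, so that
-- min^(t) is the least size of a set admissible for some k.  In Ĝ(v) every edge between the two
-- sides joins TS(v_l) to TS(v_r).  Hence a set admissible for v restricts to admissible sets of
-- v_l and v_r: a non-twin vertex can only be dominated from its own side, and a vertex matched
-- across the sides lies in the twin set, so it can be moved into the new X.  When TS(v) is the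
-- union of the children's twin sets (v labelled ⊗ or ⊙), admissible sets of the children
-- conversely combine, with the unions of their X's and matchings, into one for v; so the least
-- sizes add up.
module Submission where

open import Defs
open import Data.Bool using (Bool; true; false; _∧_)
import Data.Bool as Bool
open import Data.Empty using (⊥-elim)
open import Data.Fin using (Fin; splitAt; _↑ˡ_; _↑ʳ_)
open import Data.Fin.Properties
  using (↑ˡ-injective; ↑ʳ-injective; splitAt-↑ˡ; splitAt-↑ʳ; splitAt⁻¹-↑ˡ; splitAt⁻¹-↑ʳ; any?)
open import Data.Fin.Subset using (Subset; ⊥; _∈_; _∉_; _⊆_; _∩_; _─_; ∣_∣; inside; outside)
open import Data.Fin.Subset.Properties
  using (_∈?_; ∉⊥; p⊆q⇒∣p∣≤∣q∣; x∈p∩q⁺; x∈p∩q⁻; x∈p∧x∉q⇒x∈p─q; p─q⊆p)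
open import Data.Nat using (ℕ; suc; _+_; _≤_; _<_; _≤?_)
open import Data.Nat.Induction using (<-rec)
open import Data.Nat.Properties using (≤-trans; ≰⇒>; +-mono-≤; +-cancelʳ-≤; +-cancelˡ-≤)
open import Data.Product using (_×_; ∃; _,_; proj₁; proj₂)
import Data.Product as Prod
open import Data.Sum using (_⊎_; inj₁; inj₂)
import Data.Sum as Sum
open import Data.Vec using (lookup; _++_; []; _∷_; tabulate; here; there)
import Data.Vec as Vec
open import Data.Vec.Properties
  using ([]=⇒lookup; lookup⇒[]=; lookup-++ˡ; lookup-++ʳ; lookup∘tabulate; zipWith-++)
open import Function using (_∘_)
open import Function.Bundles using (_⇔_; mk⇔; module Equivalence)
open import Level using (0ℓ)
open import Relation.Binary.PropositionalEquality
  using (_≡_; _≢_; refl; sym; trans; cong; cong₂; subst; subst₂)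
open import Relation.Nullary using (¬_; does; yes; no; ¬?)
open import Relation.Nullary.Decidable using (dec-true; _×-dec_; decidable-stable)
open import Relation.Unary using (Pred; Decidable)

open Equivalence using (to; from)

module _ {m n : ℕ} {p : Subset m} {q : Subset n} where

  ∈-++⁺ˡ : ∀ {a} → a ∈ p → a ↑ˡ n ∈ p ++ q
  ∈-++⁺ˡ {a} a∈p = lookup⇒[]= _ _ (trans (lookup-++ˡ p q a) ([]=⇒lookup a∈p))

  ∈-++⁻ˡ : ∀ {a} → a ↑ˡ n ∈ p ++ q → a ∈ p
  ∈-++⁻ˡ {a} a∈p++q = lookup⇒[]= _ _ (trans (sym (lookup-++ˡ p q a)) ([]=⇒lookup a∈p++q))

  ∈-++⁺ʳ : ∀ {b} → b ∈ q → m ↑ʳ b ∈ p ++ q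
  ∈-++⁺ʳ {b} b∈q = lookup⇒[]= _ _ (trans (lookup-++ʳ p q b) ([]=⇒lookup b∈q))

  ∈-++⁻ʳ : ∀ {b} → m ↑ʳ b ∈ p ++ q → b ∈ q
  ∈-++⁻ʳ {b} b∈p++q = lookup⇒[]= _ _ (trans (sym (lookup-++ʳ p q b)) ([]=⇒lookup b∈p++q))

∣p++q∣≡∣p∣+∣q∣ : ∀ {m n} (p : Subset m) (q : Subset n) → ∣ p ++ q ∣ ≡ ∣ p ∣ + ∣ q ∣
∣p++q∣≡∣p∣+∣q∣ []            q = refl
∣p++q∣≡∣p∣+∣q∣ (inside ∷ p)  q = cong suc (∣p++q∣≡∣p∣+∣q∣ p q)
∣p++q∣≡∣p∣+∣q∣ (outside ∷ p) q = ∣p++q∣≡∣p∣+∣q∣ p q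

x∈p─q⇒x∉q : ∀ {n} {p q : Subset n} {x} → x ∈ p ─ q → x ∉ q
x∈p─q⇒x∉q {p = _ ∷ _} {_ ∷ _} () here
x∈p─q⇒x∉q {p = _ ∷ _} {_ ∷ _} (there x∈p─q) (there x∈q) = x∈p─q⇒x∉q x∈p─q x∈q

select : ∀ {n ℓ} {P : Pred (Fin n) ℓ} → Decidable P → Subset n
select P? = tabulate (λ i → does (P? i))

module _ {n ℓ} {P : Pred (Fin n) ℓ} (P? : Decidable P) where

  ∈-select⁺ : ∀ {i} → P i → i ∈ select P?
  ∈-select⁺ {i} Pi = lookup⇒[]= i _ (trans (lookup∘tabulate _ i) (dec-true (P? i) Pi))

  ∈-select⁻ : ∀ {i} → i ∈ select P? → P i
  ∈-select⁻ {i} i∈ with P? i | trans (sym (lookup∘tabulate (λ j → does (P? j)) i)) ([]=⇒lookup i∈)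
  ... | yes Pi | _ = Pi

data SplitView (m n : ℕ) : Fin (m + n) → Set where
  inˡ : (a : Fin m) → SplitView m n (a ↑ˡ n)
  inʳ : (b : Fin n) → SplitView m n (m ↑ʳ b)

splitView : ∀ m n (x : Fin (m + n)) → SplitView m n x
splitView m n x with splitAt m x in eq
... | inj₁ a = subst (SplitView m n) (splitAt⁻¹-↑ˡ eq) (inˡ a)
... | inj₂ b = subst (SplitView m n) (splitAt⁻¹-↑ʳ eq) (inʳ b)

↑ʳ≢↑ˡ : ∀ {m n} (a : Fin m) (b : Fin n) → m ↑ʳ b ≢ a ↑ˡ n
↑ʳ≢↑ˡ {m} {n} a b eq with trans (sym (splitAt-↑ʳ m n b)) (trans (cong (splitAt m) eq) (splitAt-↑ˡ m a n))
... | ()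

cross-true : ∀ lab {x y} → cross lab x y ≡ true → x ≡ true × y ≡ true
cross-true ⊗ {true} {true} _ = refl , refl
cross-true ⊕ {true} {true} _ = refl , refl

++⁺-⊆ : ∀ {m n} {p p′ : Subset m} {q q′ : Subset n} → p ⊆ p′ → q ⊆ q′ → p ++ q ⊆ p′ ++ q′
++⁺-⊆ {m} {n} {p} p⊆p′ q⊆q′ {x} x∈ with splitView m n x
... | inˡ a = ∈-++⁺ˡ (p⊆p′ (∈-++⁻ˡ x∈))
... | inʳ b = ∈-++⁺ʳ (q⊆q′ (∈-++⁻ʳ {p = p} x∈))

module _ (lab : Label) (l r : DTree) where

  adj-↑ˡ : ∀ a b → adj (node lab l r) (a ↑ˡ size r) (b ↑ˡ size r) ≡ adj l a b
  adj-↑ˡ a b rewrite splitAt-↑ˡ (size l) a (size r) | splitAt-↑ˡ (size l) b (size r) = refl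

  adj-↑ʳ : ∀ a b → adj (node lab l r) (size l ↑ʳ a) (size l ↑ʳ b) ≡ adj r a b
  adj-↑ʳ a b rewrite splitAt-↑ʳ (size l) (size r) a | splitAt-↑ʳ (size l) (size r) b = refl

  ↑ˡ~↑ʳ⇒TS : ∀ {a b} → Adj (node lab l r) (a ↑ˡ size r) (size l ↑ʳ b) → a ∈ TS l × b ∈ TS r
  ↑ˡ~↑ʳ⇒TS {a} {b} a~b rewrite splitAt-↑ˡ (size l) a (size r) | splitAt-↑ʳ (size l) (size r) b =
    Prod.map (lookup⇒[]= a (TS l)) (lookup⇒[]= b (TS r)) (cross-true lab a~b)

  ↑ʳ~↑ˡ⇒TS : ∀ {a b} → Adj (node lab l r) (size l ↑ʳ b) (a ↑ˡ size r) → a ∈ TS l × b ∈ TS r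
  ↑ʳ~↑ˡ⇒TS {a} {b} b~a rewrite splitAt-↑ʳ (size l) (size r) b | splitAt-↑ˡ (size l) a (size r) =
    Prod.map (lookup⇒[]= a (TS l)) (lookup⇒[]= b (TS r)) (cross-true lab b~a)

TS-node⊆ : ∀ lab l r → TS (node lab l r) ⊆ TS l ++ TS r
TS-node⊆ ⊗ l r x∈ = x∈
TS-node⊆ ⊙ l r x∈ = x∈
TS-node⊆ ⊕ l r {x} x∈ with splitView (size l) (size r) x
... | inˡ a = ∈-++⁺ˡ {q = TS r} (∈-++⁻ˡ {q = ⊥} x∈)
... | inʳ b = ⊥-elim (∉⊥ (∈-++⁻ʳ {p = TS l} {q = ⊥} x∈))

-- Ĝ(t) as an induced subgraph of Ĝ(u) which the rest of Ĝ(u) touches only in TS(t).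
record Embedding (t u : DTree) : Set where
  field
    ι                  : Fin (size t) → Fin (size u)
    ι-injective        : ∀ {a b} → ι a ≡ ι b → a ≡ b
    adj-ι              : ∀ a b → adj u (ι a) (ι b) ≡ adj t a b
    image?             : ∀ y → (∃ λ a → y ≡ ι a) ⊎ (∀ a → y ≢ ι a)
    outer-neighbour∈TS : ∀ {y a} → (∀ b → y ≢ ι b) → Adj u y (ι a) → a ∈ TS t
    TS-ι⁻              : ∀ {a} → ι a ∈ TS u → a ∈ TS t

  Adj-ι⁺ : ∀ {a b} → Adj t a b → Adj u (ι a) (ι b)
  Adj-ι⁺ {a} {b} = trans (adj-ι a b)

  Adj-ι⁻ : ∀ {a b} → Adj u (ι a) (ι b) → Adj t a b
  Adj-ι⁻ {a} {b} = trans (sym (adj-ι a b))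

  InClosedNbhd-ι⁺ : ∀ {S St a} → (∀ {b} → b ∈ St → ι b ∈ S) → InClosedNbhd t St a → InClosedNbhd u S (ι a)
  InClosedNbhd-ι⁺ St⇒S (b , b∈St , inj₁ b≡a)  = ι b , St⇒S b∈St , inj₁ (cong ι b≡a)
  InClosedNbhd-ι⁺ St⇒S (b , b∈St , inj₂ b~a) = ι b , St⇒S b∈St , inj₂ (Adj-ι⁺ b~a)

  restrict-dominating : ∀ {S St} → (∀ {b} → ι b ∈ S → b ∈ St) →
                        (∀ y → y ∉ TS u → InClosedNbhd u S y) → ∀ a → a ∉ TS t → InClosedNbhd t St a
  restrict-dominating S⇒St dom a a∉TS with dom (ι a) (λ ιa∈TS → a∉TS (TS-ι⁻ ιa∈TS))
  ... | y , y∈S , y-dom with image? y | y-dom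
  ... | inj₁ (b , refl) | _          = b , S⇒St y∈S , Sum.map ι-injective Adj-ι⁻ y-dom
  ... | inj₂ y∉ι        | inj₁ y≡ιa  = ⊥-elim (y∉ι a y≡ιa)
  ... | inj₂ y∉ι        | inj₂ y~ιa = ⊥-elim (a∉TS (outer-neighbour∈TS y∉ι y~ιa))

  module Restrict {S X : Subset (size u)} {St : Subset (size t)} (S⇔St : ∀ {a} → ι a ∈ S ⇔ a ∈ St)
                  (X⊆ : X ⊆ S ∩ TS u) {M} (M-perfect : IsPerfectMatching u (S ─ X) M) where

    M-edge : ∀ x y → M x y ≡ true → Adj u x y × x ∈ S ─ X × y ∈ S ─ X × M y x ≡ true
    M-edge = proj₁ M-perfect

    M-cover : ∀ x → x ∈ S ─ X → ∃ λ y → M x y ≡ true × (∀ z → M x z ≡ true → z ≡ y)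
    M-cover = proj₂ M-perfect

    Mt : Fin (size t) → Fin (size t) → Bool
    Mt a b = M (ι a) (ι b)

    Matched : Pred (Fin (size t)) 0ℓ
    Matched a = ∃ λ b → Mt a b ≡ true

    matched? : Decidable Matched
    matched? a = any? (λ b → Mt a b Bool.≟ true)

    unmatched? : Decidable (λ a → a ∈ St × ¬ Matched a)
    unmatched? a = a ∈? St ×-dec ¬? (matched? a)

    -- The vertices of St that M does not match inside Ĝ(t): those of X and those matched across.
    Xt : Subset (size t)
    Xt = select unmatched?

    Xt⊆ : Xt ⊆ St ∩ TS t
    Xt⊆ {a} a∈Xt with ∈-select⁻ unmatched? a∈Xt
    ... | a∈St , unmatched with ι a ∈? X
    ... | yes ιa∈X = x∈p∩q⁺ (a∈St , TS-ι⁻ (proj₂ (x∈p∩q⁻ S (TS u) (X⊆ ιa∈X))))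
    ... | no ιa∉X with M-cover (ι a) (x∈p∧x∉q⇒x∈p─q (from S⇔St a∈St) ιa∉X)
    ... | y , ιa~y , _ with image? y
    ... | inj₁ (b , refl) = ⊥-elim (unmatched (b , ιa~y))
    ... | inj₂ y∉ι = x∈p∩q⁺ (a∈St , outer-neighbour∈TS y∉ι y~ιa)
      where
      y~ιa : Adj u y (ι a)
      y~ιa = proj₁ (M-edge y (ι a) (proj₂ (proj₂ (proj₂ (M-edge (ι a) y ιa~y)))))

    matched⇒∈St─Xt : ∀ {a b} → Mt a b ≡ true → a ∈ St ─ Xt
    matched⇒∈St─Xt {a} {b} a~b =
      x∈p∧x∉q⇒x∈p─q (to S⇔St (p─q⊆p S X (proj₁ (proj₂ (M-edge (ι a) (ι b) a~b)))))
                    (λ a∈Xt → proj₂ (∈-select⁻ unmatched? a∈Xt) (b , a~b))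

    Mt-perfect : IsPerfectMatching t (St ─ Xt) Mt
    Mt-perfect = edge , cover
      where
      edge : ∀ a b → Mt a b ≡ true → Adj t a b × a ∈ St ─ Xt × b ∈ St ─ Xt × Mt b a ≡ true
      edge a b a~b with M-edge (ι a) (ι b) a~b
      ... | ιa~ιb , _ , _ , b~a = Adj-ι⁻ ιa~ιb , matched⇒∈St─Xt a~b , matched⇒∈St─Xt b~a , b~a

      cover : ∀ a → a ∈ St ─ Xt → ∃ λ b → Mt a b ≡ true × (∀ z → Mt a z ≡ true → z ≡ b)
      cover a a∈ with decidable-stable (matched? a)
                        (λ unmatched → x∈p─q⇒x∉q a∈ (∈-select⁺ unmatched? (p─q⊆p St Xt a∈ , unmatched)))
      ... | b , a~b with M-cover (ι a) (proj₁ (proj₂ (M-edge (ι a) (ι b) a~b)))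
      ... | _ , _ , unique = b , a~b , λ z a~z → ι-injective (trans (unique (ι z) a~z) (sym (unique (ι b) a~b)))

  restrict-admissible : ∀ {k S St} → (∀ {a} → ι a ∈ S ⇔ a ∈ St) → Admissible u k S → ∃ λ kt → Admissible t kt St
  restrict-admissible S⇔St (dom , X , X⊆ , _ , M , M-perfect) =
    ∣ Xt ∣ , restrict-dominating (to S⇔St) dom , Xt , Xt⊆ , refl , Mt , Mt-perfect
    where open Restrict S⇔St X⊆ M-perfect

↑ˡ-embedding : ∀ lab l r → Embedding l (node lab l r)
↑ˡ-embedding lab l r = record
  { ι                  = _↑ˡ size r
  ; ι-injective        = ↑ˡ-injective (size r) _ _
  ; adj-ι              = adj-↑ˡ lab l r
  ; image?             = image?
  ; outer-neighbour∈TS = outer-neighbour∈TS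
  ; TS-ι⁻              = λ a∈TS → ∈-++⁻ˡ {q = TS r} (TS-node⊆ lab l r a∈TS)
  }
  where
  image? : ∀ y → (∃ λ a → y ≡ a ↑ˡ size r) ⊎ (∀ a → y ≢ a ↑ˡ size r)
  image? y with splitView (size l) (size r) y
  ... | inˡ a = inj₁ (a , refl)
  ... | inʳ b = inj₂ (λ a → ↑ʳ≢↑ˡ a b)

  outer-neighbour∈TS : ∀ {y a} → (∀ b → y ≢ b ↑ˡ size r) → Adj (node lab l r) y (a ↑ˡ size r) → a ∈ TS l
  outer-neighbour∈TS {y} y∉ι y~a with splitView (size l) (size r) y
  ... | inˡ b = ⊥-elim (y∉ι b refl)
  ... | inʳ b = proj₁ (↑ʳ~↑ˡ⇒TS lab l r y~a)

↑ʳ-embedding : ∀ lab l r → Embedding r (node lab l r)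
↑ʳ-embedding lab l r = record
  { ι                  = size l ↑ʳ_
  ; ι-injective        = ↑ʳ-injective (size l) _ _
  ; adj-ι              = adj-↑ʳ lab l r
  ; image?             = image?
  ; outer-neighbour∈TS = outer-neighbour∈TS
  ; TS-ι⁻              = λ b∈TS → ∈-++⁻ʳ {p = TS l} (TS-node⊆ lab l r b∈TS)
  }
  where
  image? : ∀ y → (∃ λ b → y ≡ size l ↑ʳ b) ⊎ (∀ b → y ≢ size l ↑ʳ b)
  image? y with splitView (size l) (size r) y
  ... | inˡ a = inj₂ (λ b e → ↑ʳ≢↑ˡ a b (sym e))
  ... | inʳ b = inj₁ (b , refl)

  outer-neighbour∈TS : ∀ {y b} → (∀ a → y ≢ size l ↑ʳ a) → Adj (node lab l r) y (size l ↑ʳ b) → b ∈ TS r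
  outer-neighbour∈TS {y} y∉ι y~b with splitView (size l) (size r) y
  ... | inˡ a = proj₂ (↑ˡ~↑ʳ⇒TS lab l r y~b)
  ... | inʳ a = ⊥-elim (y∉ι a refl)

module _ (lab : Label) (l r : DTree) where
  private
    n₁ = size l
    n₂ = size r
    open Embedding (↑ˡ-embedding lab l r) using () renaming (Adj-ι⁺ to Adj-↑ˡ⁺; InClosedNbhd-ι⁺ to InClosedNbhd-↑ˡ⁺)
    open Embedding (↑ʳ-embedding lab l r) using () renaming (Adj-ι⁺ to Adj-↑ʳ⁺; InClosedNbhd-ι⁺ to InClosedNbhd-↑ʳ⁺)

  HasPerfectMatching-++ : ∀ {Wl Wr} → HasPerfectMatching l Wl → HasPerfectMatching r Wr →
                          HasPerfectMatching (node lab l r) (Wl ++ Wr)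
  HasPerfectMatching-++ {Wl} {Wr} (Ml , Ml-edge , Ml-cover) (Mr , Mr-edge , Mr-cover) = M , edge , cover
    where
    join : Fin n₁ ⊎ Fin n₂ → Fin n₁ ⊎ Fin n₂ → Bool
    join (inj₁ a) (inj₁ b) = Ml a b
    join (inj₂ a) (inj₂ b) = Mr a b
    join _        _        = false

    M : Fin (n₁ + n₂) → Fin (n₁ + n₂) → Bool
    M x y = join (splitAt n₁ x) (splitAt n₁ y)

    M-ˡˡ : ∀ a b → M (a ↑ˡ n₂) (b ↑ˡ n₂) ≡ Ml a b
    M-ˡˡ a b rewrite splitAt-↑ˡ n₁ a n₂ | splitAt-↑ˡ n₁ b n₂ = refl

    M-ʳʳ : ∀ a b → M (n₁ ↑ʳ a) (n₁ ↑ʳ b) ≡ Mr a b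
    M-ʳʳ a b rewrite splitAt-↑ʳ n₁ n₂ a | splitAt-↑ʳ n₁ n₂ b = refl

    M-ˡʳ : ∀ a b → M (a ↑ˡ n₂) (n₁ ↑ʳ b) ≡ false
    M-ˡʳ a b rewrite splitAt-↑ˡ n₁ a n₂ | splitAt-↑ʳ n₁ n₂ b = refl

    M-ʳˡ : ∀ a b → M (n₁ ↑ʳ a) (b ↑ˡ n₂) ≡ false
    M-ʳˡ a b rewrite splitAt-↑ʳ n₁ n₂ a | splitAt-↑ˡ n₁ b n₂ = refl

    edge : ∀ x y → M x y ≡ true → Adj (node lab l r) x y × x ∈ Wl ++ Wr × y ∈ Wl ++ Wr × M y x ≡ true
    edge x y x~y with splitView n₁ n₂ x | splitView n₁ n₂ y
    ... | inˡ a | inˡ b with Ml-edge a b (trans (sym (M-ˡˡ a b)) x~y)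
    ...   | a~b , a∈ , b∈ , b~a = Adj-↑ˡ⁺ a~b , ∈-++⁺ˡ a∈ , ∈-++⁺ˡ b∈ , trans (M-ˡˡ b a) b~a
    edge x y x~y | inʳ a | inʳ b with Mr-edge a b (trans (sym (M-ʳʳ a b)) x~y)
    ...   | a~b , a∈ , b∈ , b~a = Adj-↑ʳ⁺ a~b , ∈-++⁺ʳ a∈ , ∈-++⁺ʳ b∈ , trans (M-ʳʳ b a) b~a
    edge x y x~y | inˡ a | inʳ b with trans (sym (M-ˡʳ a b)) x~y
    ... | ()
    edge x y x~y | inʳ a | inˡ b with trans (sym (M-ʳˡ a b)) x~y
    ... | ()

    cover : ∀ x → x ∈ Wl ++ Wr → ∃ λ y → M x y ≡ true × (∀ z → M x z ≡ true → z ≡ y)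
    cover x x∈ with splitView n₁ n₂ x
    ... | inˡ a with Ml-cover a (∈-++⁻ˡ x∈)
    ...   | b , a~b , unique = b ↑ˡ n₂ , trans (M-ˡˡ a b) a~b , unique′
      where
      unique′ : ∀ z → M (a ↑ˡ n₂) z ≡ true → z ≡ b ↑ˡ n₂
      unique′ z a~z with splitView n₁ n₂ z
      ... | inˡ c = cong (_↑ˡ n₂) (unique c (trans (sym (M-ˡˡ a c)) a~z))
      ... | inʳ c with trans (sym (M-ˡʳ a c)) a~z
      ...   | ()
    cover x x∈ | inʳ a with Mr-cover a (∈-++⁻ʳ {p = Wl} x∈)
    ...   | b , a~b , unique = n₁ ↑ʳ b , trans (M-ʳʳ a b) a~b , unique′
      where
      unique′ : ∀ z → M (n₁ ↑ʳ a) z ≡ true → z ≡ n₁ ↑ʳ b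
      unique′ z a~z with splitView n₁ n₂ z
      ... | inˡ c with trans (sym (M-ʳˡ a c)) a~z
      ...   | ()
      unique′ z a~z | inʳ c = cong (n₁ ↑ʳ_) (unique c (trans (sym (M-ʳʳ a c)) a~z))

  Admissible-++⁻ : ∀ {k Sl Sr} → Admissible (node lab l r) k (Sl ++ Sr) →
                   (∃ λ kl → Admissible l kl Sl) × (∃ λ kr → Admissible r kr Sr)
  Admissible-++⁻ {Sl = Sl} adm =
    Embedding.restrict-admissible (↑ˡ-embedding lab l r) (mk⇔ ∈-++⁻ˡ ∈-++⁺ˡ) adm ,
    Embedding.restrict-admissible (↑ʳ-embedding lab l r) (mk⇔ (∈-++⁻ʳ {p = Sl}) ∈-++⁺ʳ) adm

  Admissible-++ : TS (node lab l r) ≡ TS l ++ TS r → ∀ {kl kr Sl Sr} →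
                  Admissible l kl Sl → Admissible r kr Sr → Admissible (node lab l r) (kl + kr) (Sl ++ Sr)
  Admissible-++ TS≡ {Sl = Sl} {Sr} (domˡ , Xl , Xl⊆ , ∣Xl∣≡ , pmˡ) (domʳ , Xr , Xr⊆ , ∣Xr∣≡ , pmʳ) =
    dom , Xl ++ Xr , X⊆ , trans (∣p++q∣≡∣p∣+∣q∣ Xl Xr) (cong₂ _+_ ∣Xl∣≡ ∣Xr∣≡) , pm
    where
    dom : ∀ x → x ∉ TS (node lab l r) → InClosedNbhd (node lab l r) (Sl ++ Sr) x
    dom x x∉TS with splitView n₁ n₂ x
    ... | inˡ a = InClosedNbhd-↑ˡ⁺ ∈-++⁺ˡ (domˡ a (λ a∈TS → x∉TS (subst (x ∈_) (sym TS≡) (∈-++⁺ˡ a∈TS))))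
    ... | inʳ b = InClosedNbhd-↑ʳ⁺ ∈-++⁺ʳ (domʳ b (λ b∈TS → x∉TS (subst (x ∈_) (sym TS≡) (∈-++⁺ʳ b∈TS))))

    X⊆ : Xl ++ Xr ⊆ (Sl ++ Sr) ∩ TS (node lab l r)
    X⊆ = subst (Xl ++ Xr ⊆_) (sym (trans (cong ((Sl ++ Sr) ∩_) TS≡) (zipWith-++ _∧_ Sl Sr (TS l) (TS r))))
               (++⁺-⊆ Xl⊆ Xr⊆)

    pm : HasPerfectMatching (node lab l r) ((Sl ++ Sr) ─ (Xl ++ Xr))
    pm = subst (HasPerfectMatching (node lab l r)) (sym (zipWith-++ _ Sl Sr Xl Xr)) (HasPerfectMatching-++ pmˡ pmʳ)

Admissible⇒k≤∣TS∣ : ∀ {t k S} → Admissible t k S → k ≤ ∣ TS t ∣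
Admissible⇒k≤∣TS∣ {t} {S = S} (_ , X , X⊆ , refl , _) = p⊆q⇒∣p∣≤∣q∣ (λ x∈X → proj₂ (x∈p∩q⁻ S (TS t) (X⊆ x∈X)))

¬¬-least : ∀ {ℓ} (P : ℕ → Set ℓ) {n} → P n → ¬ ¬ (∃ λ m → P m × (∀ k → P k → m ≤ k))
¬¬-least {ℓ} P {n} = <-rec (λ n → P n → ¬ ¬ Least) step n
  where
  Least : Set ℓ
  Least = ∃ λ m → P m × (∀ k → P k → m ≤ k)

  step : ∀ n → (∀ {k} → k < n → P k → ¬ ¬ Least) → P n → ¬ ¬ Least
  step n below Pn ¬least = ¬least (n , Pn , λ k Pk → decidable-stable (n ≤? k) (λ n≰k → below (≰⇒> n≰k) Pk ¬least))

-- γ̂_k(t) exists only classically (admissibility is not decided here), but the goal is decidable.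
IsMinHat-≤ : ∀ {t m k S} → IsMinHat t m → Admissible t k S → m ≤ ∣ S ∣
IsMinHat-≤ {t} {m} {k} {S} (_ , min≤γ) adm = decidable-stable (m ≤? ∣ S ∣) λ m≰∣S∣ →
  ¬¬-least (λ n → ∃ λ S′ → Admissible t k S′ × ∣ S′ ∣ ≡ n) (S , adm , refl)
    λ { (γ , (S′ , adm′ , refl) , least) →
        m≰∣S∣ (≤-trans (min≤γ k (Admissible⇒k≤∣TS∣ {t} adm) γ ((S′ , adm′ , refl) , λ S″ adm″ → least _ (S″ , adm″ , refl)))
                       (least _ (S , adm , refl))) }

IsLeastAdmissibleSize : DTree → ℕ → Set
IsLeastAdmissibleSize t m =
  (∃ λ k → ∃ λ S → Admissible t k S × ∣ S ∣ ≡ m) × (∀ {k S} → Admissible t k S → m ≤ ∣ S ∣)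

IsMinHat⇔IsLeastAdmissibleSize : ∀ t {m} → IsMinHat t m ⇔ IsLeastAdmissibleSize t m
IsMinHat⇔IsLeastAdmissibleSize t {m} = mk⇔
  (λ { minHat@((k , _ , (S , adm , ∣S∣≡m) , _) , _) → (k , S , adm , ∣S∣≡m) , IsMinHat-≤ {t} minHat })
  (λ { ((k , S , adm , ∣S∣≡m) , least) →
       (k , Admissible⇒k≤∣TS∣ {t} adm , (S , adm , ∣S∣≡m) , λ _ → least) ,
       λ { _ _ γ ((S′ , adm′ , refl) , _) → least adm′ } })

SumOf : (DTree → ℕ → Set) → DTree → DTree → ℕ → Set
SumOf P l r m = ∃ λ a → ∃ λ b → P l a × P r b × m ≡ a + b

SumOf-map : ∀ {P Q : DTree → ℕ → Set} {l r m} → (∀ {t n} → P t n → Q t n) → SumOf P l r m → SumOf Q l r m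
SumOf-map f (a , b , Pa , Pb , m≡) = a , b , f Pa , f Pb , m≡

module _ (lab : Label) (l r : DTree) (TS≡ : TS (node lab l r) ≡ TS l ++ TS r) where

  IsLeastAdmissibleSize-node : ∀ {m} → IsLeastAdmissibleSize (node lab l r) m ⇔ SumOf IsLeastAdmissibleSize l r m
  IsLeastAdmissibleSize-node {m} = mk⇔ split join
    where
    split : IsLeastAdmissibleSize (node lab l r) m → SumOf IsLeastAdmissibleSize l r m
    split ((k , S , adm , ∣S∣≡m) , least) with Vec.splitAt (size l) S
    ... | Sl , Sr , refl with Admissible-++⁻ lab l r {Sl = Sl} {Sr} adm
    ... | (kl , admˡ) , (kr , admʳ) =
      ∣ Sl ∣ , ∣ Sr ∣ , ((kl , Sl , admˡ , refl) , leastˡ) , ((kr , Sr , admʳ , refl) , leastʳ) , m≡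
      where
      m≡ : m ≡ ∣ Sl ∣ + ∣ Sr ∣
      m≡ = trans (sym ∣S∣≡m) (∣p++q∣≡∣p∣+∣q∣ Sl Sr)

      leastˡ : ∀ {k′ S′} → Admissible l k′ S′ → ∣ Sl ∣ ≤ ∣ S′ ∣
      leastˡ {S′ = S′} adm′ = +-cancelʳ-≤ (∣ Sr ∣) (∣ Sl ∣) (∣ S′ ∣)
        (subst₂ _≤_ m≡ (∣p++q∣≡∣p∣+∣q∣ S′ Sr) (least (Admissible-++ lab l r TS≡ adm′ admʳ)))

      leastʳ : ∀ {k′ S′} → Admissible r k′ S′ → ∣ Sr ∣ ≤ ∣ S′ ∣
      leastʳ {S′ = S′} adm′ = +-cancelˡ-≤ (∣ Sl ∣) (∣ Sr ∣) (∣ S′ ∣)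
        (subst₂ _≤_ m≡ (∣p++q∣≡∣p∣+∣q∣ Sl S′) (least (Admissible-++ lab l r TS≡ admˡ adm′)))

    join : SumOf IsLeastAdmissibleSize l r m → IsLeastAdmissibleSize (node lab l r) m
    join (_ , _ , ((kl , Sl , admˡ , refl) , leastˡ) , ((kr , Sr , admʳ , refl) , leastʳ) , refl) =
      (kl + kr , Sl ++ Sr , Admissible-++ lab l r TS≡ admˡ admʳ , ∣p++q∣≡∣p∣+∣q∣ Sl Sr) , least
      where
      least : ∀ {k S} → Admissible (node lab l r) k S → ∣ Sl ∣ + ∣ Sr ∣ ≤ ∣ S ∣
      least {S = S} adm with Vec.splitAt (size l) S
      ... | Sl′ , Sr′ , refl with Admissible-++⁻ lab l r {Sl = Sl′} {Sr′} adm
      ... | (_ , admˡ′) , (_ , admʳ′) =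
        subst (∣ Sl ∣ + ∣ Sr ∣ ≤_) (sym (∣p++q∣≡∣p∣+∣q∣ Sl′ Sr′)) (+-mono-≤ (leastˡ admˡ′) (leastʳ admʳ′))

  IsMinHat-node : ∀ {m} → IsMinHat (node lab l r) m ⇔ SumOf IsMinHat l r m
  IsMinHat-node {m} = mk⇔
    (SumOf-map {l = l} {r} (λ {t} {n} → from (IsMinHat⇔IsLeastAdmissibleSize t {n}))
       ∘ to (IsLeastAdmissibleSize-node {m}) ∘ to (IsMinHat⇔IsLeastAdmissibleSize (node lab l r) {m}))
    (from (IsMinHat⇔IsLeastAdmissibleSize (node lab l r) {m}) ∘ from (IsLeastAdmissibleSize-node {m})
       ∘ SumOf-map {l = l} {r} (λ {t} {n} → to (IsMinHat⇔IsLeastAdmissibleSize t {n})))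

lemma6 : (l r : DTree) (m : ℕ) →
    IsMinHat (node ⊗ l r) m ⇔ (∃ λ a → ∃ λ b → IsMinHat l a × IsMinHat r b × m ≡ a + b)
lemma6 l r m = IsMinHat-node ⊗ l r refl
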